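{- Let $G$ be a cograph and let $\lambda\neq 0,-1$ be an eigenvalue of $G$. Then the multiplicity of $\lambda$ as an eigenvalue of $G$ is at most the total number of duplication classes and coduplication classes of $G$.
   Context: A cograph is a finite simple graph that contains no induced subgraph isomorphic to the path on $4$ vertices. Eigenvalues of a graph are those of its adjacency matrix. For a vertex $v$, $N(v)$ is its open neighborhood and $N[v]=N(v)\cup\{v\}$ its closed neighborhood. A duplication class of $G$ is a subset $S\subseteq V(G)$ with $|S|>1$ such that $N(u)=N(v)$ for all $u,v\in S$, and $S$ is maximal with this property; a coduplication class is defined analogously with $N[u]=N[v]$. -}

module Defs where

open import Level using (Level; _⊔_)
open import Data.Nat using (ℕ; _<_; _≤_)
open import Data.Bool using (Bool; true; false; if_then_else_; _∨_)
open import Data.Fin using (Fin; zero; suc; _≟_)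
open import Data.Fin.Subset using (Subset; _∈_; _⊆_; ∣_∣)
open import Data.Product using (Σ; _×_; _,_)
open import Data.List using (List; length)
import Data.List.Membership.Propositional as LM
open import Data.List.Relation.Unary.Unique.Propositional using (Unique)
open import Relation.Binary.PropositionalEquality using (_≡_; _≢_)
open import Relation.Nullary using (¬_; ⌊_⌋)
open import Function.Bundles using (_⇔_)
open import Algebra.Bundles using (CommutativeRing)
import Algebra.Definitions.RawMonoid as RM

record Field (c ℓ : Level) : Set (Level.suc (c ⊔ ℓ)) where
  field
    commutativeRing : CommutativeRing c ℓ
  open CommutativeRing commutativeRing public
  field
    0≉1     : ¬ (0# ≈ 1#)
    inverse : ∀ x → ¬ (x ≈ 0#) → Σ Carrier (λ y → (x * y) ≈ 1#)

CharZero : ∀ {c ℓ} → Field c ℓ → Set ℓ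
CharZero F = ∀ (n : ℕ) → Field._≈_ F (RM._×_ (Field.+-rawMonoid F) n (Field.1# F)) (Field.0# F) → n ≡ 0

record Graph (n : ℕ) : Set where
  field
    adj   : Fin n → Fin n → Bool
    sym   : ∀ u v → adj u v ≡ adj v u
    irref : ∀ v → adj v v ≡ false
open Graph public

IsCograph : ∀ {n} → Graph n → Set
IsCograph G = ∀ a b c d →
  a ≢ b → a ≢ c → a ≢ d → b ≢ c → b ≢ d → c ≢ d →
  adj G a b ≡ true → adj G b c ≡ true → adj G c d ≡ true →
  adj G a c ≡ false → adj G b d ≡ false → adj G a d ≡ false →
  Data.Empty.⊥
  where import Data.Empty

N : ∀ {n} → Graph n → Fin n → Fin n → Bool
N G u w = adj G u w

N[_] : ∀ {n} → Graph n → Fin n → Fin n → Bool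
N[ G ] u w = adj G u w ∨ ⌊ u ≟ w ⌋

SameN : ∀ {n} → Graph n → Fin n → Fin n → Set
SameN G u v = ∀ w → N G u w ≡ N G v w

SameN[] : ∀ {n} → Graph n → Fin n → Fin n → Set
SameN[] G u v = ∀ w → N[ G ] u w ≡ N[ G ] v w

IsClassFor : ∀ {n} → (Fin n → Fin n → Set) → Subset n → Set
IsClassFor {n} R S =
  (1 < ∣ S ∣) ×
  (∀ u v → u ∈ S → v ∈ S → R u v) ×
  (∀ (T : Subset n) → S ⊆ T → (∀ u v → u ∈ T → v ∈ T → R u v) → T ≡ S)

IsDuplicationClass : ∀ {n} → Graph n → Subset n → Set
IsDuplicationClass G = IsClassFor (SameN G)

IsCoduplicationClass : ∀ {n} → Graph n → Subset n → Set
IsCoduplicationClass G = IsClassFor (SameN[] G)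

Enumerates : ∀ {n} → (Subset n → Set) → List (Subset n) → Set
Enumerates {n} P xs = Unique xs × (∀ (S : Subset n) → (S LM.∈ xs) ⇔ P S)

module LinAlg {c ℓ} (F : Field c ℓ) where
  open Field F using (Carrier; _≈_; _+_; _*_; 0#; 1#)

  Vector : ℕ → Set c
  Vector n = Fin n → Carrier

  sumF : ∀ {n} → (Fin n → Carrier) → Carrier
  sumF {ℕ.zero}  f = 0#
  sumF {ℕ.suc n} f = f zero + sumF (λ i → f (suc i))

  A : ∀ {n} → Graph n → Fin n → Fin n → Carrier
  A G i j = if adj G i j then 1# else 0#

  Amul : ∀ {n} → Graph n → Vector n → Vector n
  Amul G x i = sumF (λ j → A G i j * x j)

  IsZeroVec : ∀ {n} → Vector n → Set ℓ
  IsZeroVec x = ∀ i → x i ≈ 0#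

  InEigenspace : ∀ {n} → Graph n → Carrier → Vector n → Set ℓ
  InEigenspace G λ' x = ∀ i → Amul G x i ≈ (λ' * x i)

  IsEigenvalue : ∀ {n} → Graph n → Carrier → Set (c ⊔ ℓ)
  IsEigenvalue {n} G λ' = Σ (Vector n) (λ x → ¬ IsZeroVec x × InEigenspace G λ' x)

  LinearlyIndependent : ∀ {n k} → (Fin k → Vector n) → Set (c ⊔ ℓ)
  LinearlyIndependent {n} {k} v =
    ∀ (a : Fin k → Carrier) →
      (∀ i → sumF (λ j → a j * v j i) ≈ 0#) → ∀ j → a j ≈ 0#

  MultiplicityAtMost : ∀ {n} → Graph n → Carrier → ℕ → Set (c ⊔ ℓ)
  MultiplicityAtMost {n} G λ' m =
    ∀ (k : ℕ) (v : Fin k → Vector n) →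
      (∀ j → InEigenspace G λ' (v j)) → LinearlyIndependent v → k ≤ m

-- Restrict the λ-eigenvectors to one representative vertex of each (co)duplication class:
-- the bound follows once this restriction is injective on the eigenspace. Twins carry equal
-- entries of a λ-eigenvector (duplicates since λ ≠ 0, coduplicates since λ ≠ -1), so an
-- eigenvector y vanishing at the representatives vanishes at every vertex that has a twin.
-- As G has no induced P4, every vertex set with two or more vertices splits into two parts
-- whose cross pairs are all adjacent or all non-adjacent. On a module S the equation Ay = λy
-- reads, at the vertices of S, as the eigen-equation of G[S] up to a constant κ contributed
-- from outside S. Recursing along the splits, each part is a single vertex or carries y = 0
-- and κ = 0; two single-vertex parts are twins, and otherwise one vanishing part forces κ = 0
-- and then the other part to vanish (through λ ≠ -1 when the parts are completely joined).

module Submission where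

open import Defs hiding (sym)
open import Data.Nat using (ℕ)
import Data.Nat as ℕ
open import Data.List using (List; length)
open import Data.Fin.Subset using (Subset)
open import Relation.Nullary using (¬_)

open import Level using (_⊔_)
open import Data.Nat using (zero; suc; _≤_; _<_; z≤n; s≤s)
open import Data.Nat.Properties using (_≤?_; m≤n⇒m≤1+n; n≮0)
open import Data.Bool using (Bool; true; false; not; _∨_; if_then_else_)
open import Data.Bool.Properties using (not-¬; ¬-not; not-involutive)
import Data.Bool.Properties as Bool
open import Data.Empty using (⊥-elim)
import Data.Empty as Empty
open import Data.Fin using (Fin; zero; suc; punchIn; _≟_)
open import Data.Fin.Properties using (punchInᵢ≢i; any?; all?)
open import Data.Fin.Subset using (_∈_; _∉_; _⊆_; _⊂_; _∪_; _∩_; ∁; ⁅_⁆; ⊤; ⊥; Nonempty; ∣_∣)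
open import Data.Fin.Subset.Properties
  using (_∈?_; x∈⁅x⁆; x∈⁅y⁆⇒x≡y; x≢y⇒x∉⁅y⁆; ∈⊤; ∉⊥; x∈p∪q⁻; p⊆p∪q; q⊆p∪q;
         x∈p∩q⁺; x∈p∩q⁻; x∈∁p⇒x∉p; x∉p⇒x∈∁p; ⊆-antisym; ∪-assoc; ∪-comm; ∪-identityˡ;
         ∩-distribˡ-∪; ∩-identityʳ; p∪∁p≡⊤; nonempty?; Empty-unique; p⊂q⇒∣p∣<∣q∣;
         ∣⁅x⁆∣≡1; ∣⊥∣≡0)
open import Data.Fin.Subset.Induction using (⊂-wellFounded)
open import Data.List using (_++_; lookup)
open import Data.List.Properties using (length-++)
import Data.List.Membership.Propositional as LM
open import Data.List.Membership.Propositional.Properties using (∈-lookup; ∈-++⁻; ∈-++⁺ˡ; ∈-++⁺ʳ)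
open import Data.List.Relation.Unary.Any using (index)
open import Data.List.Relation.Unary.Any.Properties using (lookup-index)
open import Data.Product using (∃; _×_; _,_; proj₁; proj₂)
open import Data.Sum using (_⊎_; inj₁; inj₂; [_,_]′)
open import Data.Vec using (tabulate)
open import Data.Vec.Properties using (lookup∘tabulate; []=⇒lookup; lookup⇒[]=)
open import Data.Vec.Functional using (tail; insertAt; removeAt)
open import Data.Vec.Functional.Properties using (insertAt-lookup; insertAt-punchIn)
open import Function using (_∘_)
open import Function.Bundles using (Equivalence)
open import Induction.WellFounded using (Acc; acc)
open import Relation.Binary.PropositionalEquality as ≡ using (_≡_; _≢_)
open import Relation.Nullary using (Dec; yes; no; does)
open import Relation.Nullary.Decidable
  using (decidable-stable; dec-true; dec-false; _×-dec_; ¬¬-excluded-middle)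
open import Relation.Unary using (Pred; Decidable)

module FieldProperties {c ℓ} (F : Field c ℓ) where
  open Field F hiding (zero)
  open LinAlg F using (Vector; sumF)
  open import Relation.Binary.Reasoning.Setoid setoid
  open import Algebra.Properties.Semiring.Sum semiring

  *-cancelˡ : ∀ {r a b} → r ≉ 0# → r * a ≈ r * b → a ≈ b
  *-cancelˡ {r} {a} {b} r≉0 ra≈rb with inverse r r≉0
  ... | q , rq≈1 = begin
    a           ≈⟨ undo a ⟨
    q * (r * a) ≈⟨ *-congˡ ra≈rb ⟩
    q * (r * b) ≈⟨ undo b ⟩
    b           ∎
    where
    undo : ∀ x → q * (r * x) ≈ x
    undo x = begin
      q * (r * x) ≈⟨ *-assoc q r x ⟨
      q * r * x   ≈⟨ *-congʳ (trans (*-comm q r) rq≈1) ⟩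
      1# * x      ≈⟨ *-identityˡ x ⟩
      x           ∎

  r*a≈0⇒a≈0 : ∀ {r a} → r ≉ 0# → r * a ≈ 0# → a ≈ 0#
  r*a≈0⇒a≈0 r≉0 ra≈0 = *-cancelˡ r≉0 (trans ra≈0 (sym (zeroʳ _)))

  x≉-1⇒x+1≉0 : ∀ {x} → x ≉ - 1# → x + 1# ≉ 0#
  x≉-1⇒x+1≉0 {x} x≉-1 x+1≈0 = x≉-1 (begin
    x               ≈⟨ +-identityʳ x ⟨
    x + 0#          ≈⟨ +-congˡ (-‿inverseʳ 1#) ⟨
    x + (1# + - 1#) ≈⟨ +-assoc x 1# (- 1#) ⟨
    x + 1# + - 1#   ≈⟨ +-congʳ x+1≈0 ⟩
    0# + - 1#       ≈⟨ +-identityˡ (- 1#) ⟩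
    - 1#            ∎)

  sumF≡sum : ∀ {n} (f : Vector n) → sumF f ≡ sum f
  sumF≡sum {zero}  f = ≡.refl
  sumF≡sum {suc n} f = ≡.cong (f zero +_) (sumF≡sum (tail f))

  sumF-cong : ∀ {n} {f g : Vector n} → (∀ i → f i ≈ g i) → sumF f ≈ sumF g
  sumF-cong {f = f} {g} f≈g rewrite sumF≡sum f | sumF≡sum g = sum-cong-≋ f≈g

  sumF-zero : ∀ {n} {f : Vector n} → (∀ i → f i ≈ 0#) → sumF f ≈ 0#
  sumF-zero {n} f≈0 =
    trans (sumF-cong f≈0) (trans (reflexive (sumF≡sum {n} (λ _ → 0#))) (sum-replicate-zero n))

  sumF-+ : ∀ {n} (f g : Vector n) → sumF (λ i → f i + g i) ≈ sumF f + sumF g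
  sumF-+ f g rewrite sumF≡sum (λ i → f i + g i) | sumF≡sum f | sumF≡sum g = ∑-distrib-+ f g

  *-distribˡ-sumF : ∀ {n} x (f : Vector n) → x * sumF f ≈ sumF (λ i → x * f i)
  *-distribˡ-sumF x f rewrite sumF≡sum f | sumF≡sum (λ i → x * f i) = *-distribˡ-sum x f

  *-distribʳ-sumF : ∀ {n} x (f : Vector n) → sumF f * x ≈ sumF (λ i → f i * x)
  *-distribʳ-sumF x f rewrite sumF≡sum f | sumF≡sum (λ i → f i * x) = *-distribʳ-sum x f

  sumF-comm : ∀ {m n} (f : Fin m → Fin n → Carrier) →
              sumF (λ i → sumF (f i)) ≈ sumF (λ j → sumF (λ i → f i j))
  sumF-comm f = begin
    sumF (λ i → sumF (f i))           ≈⟨ sumF-cong (λ i → reflexive (sumF≡sum (f i))) ⟩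
    sumF (λ i → sum (f i))            ≡⟨ sumF≡sum (λ i → sum (f i)) ⟩
    sum (λ i → sum (f i))             ≈⟨ ∑-comm f ⟩
    sum (λ j → sum (λ i → f i j))     ≡⟨ sumF≡sum (λ j → sum (λ i → f i j)) ⟨
    sumF (λ j → sum (λ i → f i j))    ≈⟨ sumF-cong (λ j → reflexive (sumF≡sum (λ i → f i j))) ⟨
    sumF (λ j → sumF (λ i → f i j))   ∎

  sumF-remove : ∀ {n} (f : Vector (suc n)) i → sumF f ≈ f i + sumF (removeAt f i)
  sumF-remove f i rewrite sumF≡sum f | sumF≡sum (removeAt f i) = sum-remove f

  sumF-single : ∀ {n} (f : Vector n) i → (∀ j → j ≢ i → f j ≈ 0#) → sumF f ≈ f i
  sumF-single {suc n} f i others≈0 = begin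
    sumF f                     ≈⟨ sumF-remove f i ⟩
    f i + sumF (removeAt f i)  ≈⟨ +-congˡ (sumF-zero (λ j → others≈0 _ (punchInᵢ≢i i j))) ⟩
    f i + 0#                   ≈⟨ +-identityʳ (f i) ⟩
    f i                        ∎

module Independence {c ℓ} (F : Field c ℓ) where
  open Field F hiding (zero)
  open LinAlg F
  open FieldProperties F
  open import Algebra.Properties.Ring ring using (-‿distribˡ-*)
  open import Relation.Binary.Reasoning.Setoid setoid

  ¬¬-all-zero-or-pivot : ∀ {k} (u : Vector k) → ¬ ¬ ((∀ j → u j ≈ 0#) ⊎ ∃ λ j → u j ≉ 0#)
  ¬¬-all-zero-or-pivot {zero}  u refute = refute (inj₁ λ ())
  ¬¬-all-zero-or-pivot {suc k} u refute = ¬¬-excluded-middle λ where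
    (no u₀≉0)  → refute (inj₂ (zero , u₀≉0))
    (yes u₀≈0) → ¬¬-all-zero-or-pivot (tail u) λ where
      (inj₁ rest≈0)     → refute (inj₁ λ { zero → u₀≈0 ; (suc j) → rest≈0 j })
      (inj₂ (j , uj≉0)) → refute (inj₂ (suc j , uj≉0))

  independent-tail : ∀ {k m} (w : Fin k → Vector (suc m)) → (∀ j → w j zero ≈ 0#) →
                     LinearlyIndependent w → LinearlyIndependent (λ j → tail (w j))
  independent-tail w w₀≈0 w-independent a combination≈0 = w-independent a λ where
    zero    → sumF-zero (λ j → trans (*-congˡ (w₀≈0 j)) (zeroʳ (a j)))
    (suc i) → combination≈0 i

  -- A Gaussian elimination step with pivot vector w j₀; q inverts its first entry.
  eliminate : ∀ {k m} → (Fin (suc k) → Vector (suc m)) → Fin (suc k) → Carrier → Fin k → Vector (suc m)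
  eliminate w j₀ q j i = w (punchIn j₀ j) i + - (w (punchIn j₀ j) zero * q) * w j₀ i

  module _ {k m} (w : Fin (suc k) → Vector (suc m)) (j₀ : Fin (suc k)) {q : Carrier}
           (pq≈1 : w j₀ zero * q ≈ 1#) where

    eliminate-zero : ∀ j → eliminate w j₀ q j zero ≈ 0#
    eliminate-zero j = begin
      y + - (y * q) * p   ≈⟨ +-congˡ (-‿distribˡ-* (y * q) p) ⟨
      y + - (y * q * p)   ≈⟨ +-congˡ (-‿cong (*-assoc y q p)) ⟩
      y + - (y * (q * p)) ≈⟨ +-congˡ (-‿cong (*-congˡ (trans (*-comm q p) pq≈1))) ⟩
      y + - (y * 1#)      ≈⟨ +-congˡ (-‿cong (*-identityʳ y)) ⟩
      y + - y             ≈⟨ -‿inverseʳ y ⟩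
      0#                  ∎
      where
      y = w (punchIn j₀ j) zero
      p = w j₀ zero

    -- A combination b of the eliminated vectors is the combination a of w that puts t on the pivot.
    independent-eliminate : LinearlyIndependent w → LinearlyIndependent (eliminate w j₀ q)
    independent-eliminate w-independent b combination≈0 j = begin
      b j              ≡⟨ insertAt-punchIn b j₀ t j ⟨
      a (punchIn j₀ j) ≈⟨ w-independent a (λ i → trans (same-combination i) (combination≈0 i)) _ ⟩
      0#               ∎
      where
      multiplier : Fin k → Carrier
      multiplier j = - (w (punchIn j₀ j) zero * q)
      t : Carrier
      t = sumF (λ j → b j * multiplier j)
      a : Vector (suc k)
      a = insertAt b j₀ t
      regroup : ∀ β μ x z → β * μ * z + β * x ≈ β * (x + μ * z)
      regroup β μ x z = begin
        β * μ * z + β * x   ≈⟨ +-congʳ (*-assoc β μ z) ⟩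
        β * (μ * z) + β * x ≈⟨ +-comm _ _ ⟩
        β * x + β * (μ * z) ≈⟨ distribˡ β x (μ * z) ⟨
        β * (x + μ * z)     ∎
      same-combination : ∀ i → sumF (λ z → a z * w z i) ≈ sumF (λ j → b j * eliminate w j₀ q j i)
      same-combination i = begin
        sumF (λ z → a z * w z i)
          ≈⟨ sumF-remove (λ z → a z * w z i) j₀ ⟩
        a j₀ * w j₀ i + sumF (λ j → a (punchIn j₀ j) * w (punchIn j₀ j) i)
          ≈⟨ +-cong (reflexive (≡.cong (_* w j₀ i) (insertAt-lookup b j₀ t)))
                    (sumF-cong (λ j → reflexive (≡.cong (_* _) (insertAt-punchIn b j₀ t j)))) ⟩
        t * w j₀ i + sumF (λ j → b j * w (punchIn j₀ j) i)
          ≈⟨ +-congʳ (*-distribʳ-sumF (w j₀ i) (λ j → b j * multiplier j)) ⟩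
        sumF (λ j → b j * multiplier j * w j₀ i) + sumF (λ j → b j * w (punchIn j₀ j) i)
          ≈⟨ sumF-+ (λ j → b j * multiplier j * w j₀ i) (λ j → b j * w (punchIn j₀ j) i) ⟨
        sumF (λ j → b j * multiplier j * w j₀ i + b j * w (punchIn j₀ j) i)
          ≈⟨ sumF-cong (λ j → regroup (b j) (multiplier j) _ _) ⟩
        sumF (λ j → b j * eliminate w j₀ q j i) ∎

  -- Equality in F is undecidable, so the pivot is found under a double negation, which is
  -- harmless as k ≤ m is decidable.
  independent⇒≤ : ∀ {k m} (w : Fin k → Vector m) → LinearlyIndependent w → k ≤ m
  independent⇒≤ {zero}          w _             = z≤n
  independent⇒≤ {suc k} {zero}  w w-independent =
    ⊥-elim (0≉1 (sym (w-independent (λ _ → 1#) (λ ()) zero)))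
  independent⇒≤ {suc k} {suc m} w w-independent = decidable-stable (suc k ≤? suc m) λ k≰m →
    ¬¬-all-zero-or-pivot (λ j → w j zero) λ where
      (inj₁ w₀≈0) → k≰m (m≤n⇒m≤1+n
        (independent⇒≤ (λ j → tail (w j)) (independent-tail w w₀≈0 w-independent)))
      (inj₂ (j₀ , p≉0)) → let (q , pq≈1) = inverse (w j₀ zero) p≉0 in k≰m (s≤s
        (independent⇒≤ (λ j → tail (eliminate w j₀ q j))
          (independent-tail (eliminate w j₀ q) (eliminate-zero w j₀ pq≈1)
                            (independent-eliminate w j₀ pq≈1 w-independent))))

select : ∀ {n p} {P : Pred (Fin n) p} → Decidable P → Subset n
select P? = tabulate (λ w → does (P? w))

module _ {n p} {P : Pred (Fin n) p} (P? : Decidable P) where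

  ∈-select⁺ : ∀ {w} → P w → w ∈ select P?
  ∈-select⁺ {w} pw = lookup⇒[]= w _ (≡.trans (lookup∘tabulate _ w) (dec-true (P? w) pw))

  ∈-select⁻ : ∀ {w} → w ∈ select P? → P w
  ∈-select⁻ {w} w∈ with P? w | ≡.trans (≡.sym (lookup∘tabulate (λ z → does (P? z)) w)) ([]=⇒lookup w∈)
  ... | yes pw | _  = pw
  ... | no _   | ()

∪-∉ : ∀ {n} {p q : Subset n} {x} → x ∉ p → x ∉ q → x ∉ p ∪ q
∪-∉ {p = p} {q} x∉p x∉q x∈p∪q with x∈p∪q⁻ p q x∈p∪q
... | inj₁ x∈p = x∉p x∈p
... | inj₂ x∈q = x∉q x∈q

∩∪∩∁ : ∀ {n} (p q : Subset n) → (p ∩ q) ∪ (p ∩ ∁ q) ≡ p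
∩∪∩∁ p q = begin
  (p ∩ q) ∪ (p ∩ ∁ q) ≡⟨ ∩-distribˡ-∪ p q (∁ q) ⟨
  p ∩ (q ∪ ∁ q)       ≡⟨ ≡.cong (p ∩_) (p∪∁p≡⊤ q) ⟩
  p ∩ ⊤               ≡⟨ ∩-identityʳ p ⟩
  p                   ∎
  where open ≡.≡-Reasoning

module GraphModules {n} (G : Graph n) where

  Disjoint : Subset n → Subset n → Set
  Disjoint A B = ∀ {w} → w ∈ A → w ∉ B

  Uniform : Bool → Subset n → Subset n → Set
  Uniform e A B = ∀ {a b} → a ∈ A → b ∈ B → adj G a b ≡ e

  IsModule : Subset n → Set
  IsModule S = ∀ {w a b} → w ∉ S → a ∈ S → b ∈ S → adj G w a ≡ adj G w b

  Twins : Fin n → Fin n → Set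
  Twins u w = SameN G u w ⊎ SameN[] G u w

  Disjoint-sym : ∀ {A B} → Disjoint A B → Disjoint B A
  Disjoint-sym disjoint w∈B w∈A = disjoint w∈A w∈B

  adj-sym : ∀ {x y e} → adj G x y ≡ e → adj G y x ≡ e
  adj-sym {x} {y} xy = ≡.trans (Graph.sym G y x) xy

  Uniform-sym : ∀ {e A B} → Uniform e A B → Uniform e B A
  Uniform-sym uniform a∈B b∈A = adj-sym (uniform b∈A a∈B)

  module-of-part : ∀ {e A B} → IsModule (A ∪ B) → Uniform e A B → IsModule B
  module-of-part {A = A} {B} module-AB uniform {w} {b} {b′} w∉B b∈B b′∈B with w ∈? A
  ... | yes w∈A = ≡.trans (uniform w∈A b∈B) (≡.sym (uniform w∈A b′∈B))
  ... | no  w∉A = module-AB (∪-∉ w∉A w∉B) (q⊆p∪q A B b∈B) (q⊆p∪q A B b′∈B)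

  pair-module-rows : ∀ {u w z} → IsModule (⁅ u ⁆ ∪ ⁅ w ⁆) → z ≢ u → z ≢ w → adj G u z ≡ adj G w z
  pair-module-rows {u} {w} {z} module-uw z≢u z≢w =
    ≡.trans (Graph.sym G u z) (≡.trans (module-uw z∉ u∈ w∈) (Graph.sym G z w))
    where
    z∉ = ∪-∉ (x≢y⇒x∉⁅y⁆ z≢u) (x≢y⇒x∉⁅y⁆ z≢w)
    u∈ = p⊆p∪q ⁅ w ⁆ (x∈⁅x⁆ u)
    w∈ = q⊆p∪q ⁅ u ⁆ ⁅ w ⁆ (x∈⁅x⁆ w)

  pair-module⇒twins : ∀ {u w} → IsModule (⁅ u ⁆ ∪ ⁅ w ⁆) → Twins u w
  pair-module⇒twins {u} {w} module-uw with adj G u w in uw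
  ... | false = inj₁ same-open
    where
    same-open : SameN G u w
    same-open z with z ≟ u | z ≟ w
    ... | yes ≡.refl | _          = ≡.trans (irref G u) (≡.sym (≡.trans (Graph.sym G w u) uw))
    ... | no _       | yes ≡.refl = ≡.trans uw (≡.sym (irref G w))
    ... | no z≢u     | no z≢w     = pair-module-rows module-uw z≢u z≢w
  ... | true  = inj₂ same-closed
    where
    same-closed : SameN[] G u w
    same-closed z with u ≟ z | w ≟ z
    ... | yes ≡.refl | _          rewrite irref G u | Graph.sym G w u | uw = ≡.refl
    ... | no _       | yes ≡.refl rewrite irref G w | uw = ≡.refl
    ... | no u≢z     | no w≢z     = ≡.cong (_∨ false) (pair-module-rows module-uw (u≢z ∘ ≡.sym) (w≢z ∘ ≡.sym))

  data Decomposition : Subset n → Set where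
    empty     : Decomposition ⊥
    singleton : ∀ u → Decomposition ⁅ u ⁆
    split     : ∀ {A B} e → Nonempty A → Nonempty B → Disjoint A B → Uniform e A B → Decomposition (A ∪ B)

module CographDecomposition {n} (G : Graph n) (cograph : IsCograph G) where
  open GraphModules G

  separated : ∀ {p x y z} → adj G x z ≡ p → adj G y z ≡ not p → x ≢ y
  separated xz yz ≡.refl = not-¬ ≡.refl (≡.trans (≡.sym xz) yz)

  no-induced-P4 : ∀ e {a b c d} → adj G a b ≡ not e → adj G b c ≡ not e → adj G c d ≡ not e →
                  adj G a c ≡ e → adj G b d ≡ e → adj G a d ≡ e → Empty.⊥
  -- For e = false, a–b–c–d is an induced path; for e = true, b–d–a–c is. The distinctness
  -- hypotheses of IsCograph are read off the adjacency pattern.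
  no-induced-P4 false {a} {b} {c} {d} ab bc cd ac bd ad =
    cograph a b c d (separated ac bc) (separated ad cd) (separated ab (adj-sym bd))
      (separated (adj-sym ab) (adj-sym ac)) (separated (adj-sym ab) (adj-sym ad))
      (separated (adj-sym bc) (adj-sym bd)) ab bc cd ac bd ad
  no-induced-P4 true {a} {b} {c} {d} ab bc cd ac bd ad =
    cograph b d a c (separated (adj-sym ab) (adj-sym ad)) (separated bc ac)
      (separated (adj-sym ab) (adj-sym ac)) (separated (adj-sym bd) ab)
      (separated (adj-sym bd) (adj-sym bc)) (separated ad cd) bd (adj-sym ad) ac (adj-sym ab) (adj-sym cd) bc

  forced-adjacency : ∀ {e v P Q x y w} → Uniform e P Q → x ∈ P → y ∈ P → w ∈ Q →
                     adj G v x ≡ e → adj G v y ≡ not e → adj G v w ≡ not e → adj G x y ≡ e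
  forced-adjacency {e} {x = x} {y} uniform x∈P y∈P w∈Q vx vy vw with adj G x y Bool.≟ e
  ... | yes xy    = xy
  ... | no  xy≢e  = ⊥-elim (no-induced-P4 e (¬-not xy≢e) (adj-sym vy) vw (adj-sym vx)
                                          (uniform y∈P w∈Q) (uniform x∈P w∈Q))

  AdjacentIn : Fin n → Bool → Subset n → Set
  AdjacentIn v e P = ∃ λ a → a ∈ P × adj G v a ≡ e

  adjacentIn? : ∀ v e P → Dec (AdjacentIn v e P)
  adjacentIn? v e P = any? (λ a → (a ∈? P) ×-dec (adj G v a Bool.≟ e))

  uniform-from-¬adjacentIn : ∀ {v e P a} → ¬ AdjacentIn v (not e) P → a ∈ P → adj G v a ≡ e
  uniform-from-¬adjacentIn {v} {e} {a = a} none a∈P =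
    ≡.trans (¬-not (λ va → none (a , a∈P , va))) (not-involutive e)

  join-right : ∀ {A B} e v → v ∉ A → Nonempty A → Disjoint A B → Uniform e A B →
               (∀ {a} → a ∈ A → adj G v a ≡ e) → Decomposition (A ∪ (B ∪ ⁅ v ⁆))
  join-right {A} {B} e v v∉A nonempty-A disjoint uniform v-uniform =
    split e nonempty-A (v , q⊆p∪q B ⁅ v ⁆ (x∈⁅x⁆ v)) disjoint′ uniform′
    where
    disjoint′ : Disjoint A (B ∪ ⁅ v ⁆)
    disjoint′ w∈A w∈ with x∈p∪q⁻ B ⁅ v ⁆ w∈
    ... | inj₁ w∈B = disjoint w∈A w∈B
    ... | inj₂ w∈v = v∉A (≡.subst (_∈ A) (x∈⁅y⁆⇒x≡y v w∈v) w∈A)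
    uniform′ : Uniform e A (B ∪ ⁅ v ⁆)
    uniform′ a∈A b∈ with x∈p∪q⁻ B ⁅ v ⁆ b∈
    ... | inj₁ b∈B = uniform a∈A b∈B
    ... | inj₂ b∈v rewrite x∈⁅y⁆⇒x≡y v b∈v = adj-sym (v-uniform a∈A)

  -- The new parts are the e-neighbours of v in S, and the rest of S together with v. A pair
  -- inside A across these parts is e-related, as otherwise it forms an induced P4 with v and b₁
  -- (dually inside B, with a₁).
  split-by-adjacency : ∀ {A B} e v → v ∉ A ∪ B → Disjoint A B → Uniform e A B →
                       AdjacentIn v (not e) A → AdjacentIn v (not e) B → AdjacentIn v e (A ∪ B) →
                       Decomposition ((A ∪ B) ∪ ⁅ v ⁆)
  split-by-adjacency {A} {B} e v v∉S disjoint uniform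
                     (a₁ , a₁∈A , va₁) (b₁ , b₁∈B , vb₁) (z , z∈S , vz) =
    ≡.subst Decomposition regroup
      (split e (z , x∈p∩q⁺ (z∈S , ∈-select⁺ agrees? vz)) (v , q⊆p∪q _ ⁅ v ⁆ (x∈⁅x⁆ v))
             disjoint′ uniform′)
    where
    S = A ∪ B
    agrees? : ∀ w → Dec (adj G v w ≡ e)
    agrees? w = adj G v w Bool.≟ e
    X = select agrees?
    regroup : (S ∩ X) ∪ ((S ∩ ∁ X) ∪ ⁅ v ⁆) ≡ S ∪ ⁅ v ⁆
    regroup = ≡.trans (≡.sym (∪-assoc (S ∩ X) (S ∩ ∁ X) ⁅ v ⁆)) (≡.cong (_∪ ⁅ v ⁆) (∩∪∩∁ S X))
    disjoint′ : Disjoint (S ∩ X) ((S ∩ ∁ X) ∪ ⁅ v ⁆)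
    disjoint′ w∈N w∈M with x∈p∩q⁻ S X w∈N | x∈p∪q⁻ (S ∩ ∁ X) ⁅ v ⁆ w∈M
    ... | _ , w∈X | inj₁ w∈S∖X = x∈∁p⇒x∉p (proj₂ (x∈p∩q⁻ S (∁ X) w∈S∖X)) w∈X
    ... | w∈S , _ | inj₂ w∈v   = v∉S (≡.subst (_∈ S) (x∈⁅y⁆⇒x≡y v w∈v) w∈S)
    across : ∀ {x y} → x ∈ S → y ∈ S → adj G v x ≡ e → adj G v y ≡ not e → adj G x y ≡ e
    across x∈S y∈S vx vy with x∈p∪q⁻ A B x∈S | x∈p∪q⁻ A B y∈S
    ... | inj₁ x∈A | inj₁ y∈A = forced-adjacency uniform x∈A y∈A b₁∈B vx vy vb₁
    ... | inj₁ x∈A | inj₂ y∈B = uniform x∈A y∈B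
    ... | inj₂ x∈B | inj₁ y∈A = Uniform-sym uniform x∈B y∈A
    ... | inj₂ x∈B | inj₂ y∈B = forced-adjacency (Uniform-sym uniform) x∈B y∈B a₁∈A vx vy va₁
    uniform′ : Uniform e (S ∩ X) ((S ∩ ∁ X) ∪ ⁅ v ⁆)
    uniform′ x∈N y∈M with x∈p∩q⁻ S X x∈N | x∈p∪q⁻ (S ∩ ∁ X) ⁅ v ⁆ y∈M
    ... | x∈S , x∈X | inj₁ y∈S∖X =
      let (y∈S , y∈∁X) = x∈p∩q⁻ S (∁ X) y∈S∖X
      in across x∈S y∈S (∈-select⁻ agrees? x∈X) (¬-not (x∈∁p⇒x∉p y∈∁X ∘ ∈-select⁺ agrees?))
    ... | _ , x∈X | inj₂ y∈v rewrite x∈⁅y⁆⇒x≡y v y∈v = adj-sym (∈-select⁻ agrees? x∈X)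

  insert-into-split : ∀ {A B} e v → v ∉ A ∪ B → Nonempty A → Nonempty B → Disjoint A B → Uniform e A B →
                      Decomposition ((A ∪ B) ∪ ⁅ v ⁆)
  insert-into-split {A} {B} e v v∉S nonempty-A nonempty-B disjoint uniform
    with adjacentIn? v (not e) A | adjacentIn? v (not e) B | adjacentIn? v e (A ∪ B)
  ... | no none-A | _ | _ =
    ≡.subst Decomposition (≡.sym (∪-assoc A B ⁅ v ⁆))
      (join-right e v (v∉S ∘ p⊆p∪q B) nonempty-A disjoint uniform (uniform-from-¬adjacentIn none-A))
  ... | yes _ | no none-B | _ =
    ≡.subst Decomposition regroup
      (join-right e v (v∉S ∘ q⊆p∪q A B) nonempty-B (Disjoint-sym disjoint) (Uniform-sym uniform)
                  (uniform-from-¬adjacentIn none-B))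
    where
    regroup : B ∪ (A ∪ ⁅ v ⁆) ≡ (A ∪ B) ∪ ⁅ v ⁆
    regroup = ≡.trans (≡.sym (∪-assoc B A ⁅ v ⁆)) (≡.cong (_∪ ⁅ v ⁆) (∪-comm B A))
  ... | yes _ | yes _ | no none-S =
    ≡.subst Decomposition (∪-comm ⁅ v ⁆ (A ∪ B))
      (split (not e) (v , x∈⁅x⁆ v) (proj₁ nonempty-A , p⊆p∪q B (proj₂ nonempty-A)) disjoint′ uniform′)
    where
    disjoint′ : Disjoint ⁅ v ⁆ (A ∪ B)
    disjoint′ w∈v rewrite x∈⁅y⁆⇒x≡y v w∈v = v∉S
    uniform′ : Uniform (not e) ⁅ v ⁆ (A ∪ B)
    uniform′ {b = b} a∈v b∈S rewrite x∈⁅y⁆⇒x≡y v a∈v = ¬-not (λ vb → none-S (b , b∈S , vb))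
  ... | yes adjacent-A | yes adjacent-B | yes adjacent-S =
    split-by-adjacency e v v∉S disjoint uniform adjacent-A adjacent-B adjacent-S

  insert : ∀ {S} v → v ∉ S → Decomposition S → Decomposition (S ∪ ⁅ v ⁆)
  insert v v∉S empty = ≡.subst Decomposition (≡.sym (∪-identityˡ ⁅ v ⁆)) (singleton v)
  insert v v∉S (singleton u) = split (adj G u v) (u , x∈⁅x⁆ u) (v , x∈⁅x⁆ v) disjoint uniform
    where
    disjoint : Disjoint ⁅ u ⁆ ⁅ v ⁆
    disjoint w∈u w∈v rewrite x∈⁅y⁆⇒x≡y u w∈u =
      v∉S (≡.subst (_∈ ⁅ u ⁆) (x∈⁅y⁆⇒x≡y v w∈v) (x∈⁅x⁆ u))
    uniform : Uniform (adj G u v) ⁅ u ⁆ ⁅ v ⁆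
    uniform a∈u b∈v rewrite x∈⁅y⁆⇒x≡y u a∈u | x∈⁅y⁆⇒x≡y v b∈v = ≡.refl
  insert v v∉S (split e nonempty-A nonempty-B disjoint uniform) =
    insert-into-split e v v∉S nonempty-A nonempty-B disjoint uniform

  decompose : ∀ S → Decomposition S
  decompose S = by-size (⊂-wellFounded S)
    where
    by-size : ∀ {S} → Acc _⊂_ S → Decomposition S
    by-size {S} (acc smaller) with nonempty? S
    ... | no  S-empty     = ≡.subst Decomposition (≡.sym (Empty-unique S-empty)) empty
    ... | yes (x , x∈S) =
      ≡.subst Decomposition restore (insert x x∉rest (by-size (smaller (rest⊆S , x , x∈S , x∉rest))))
      where
      rest = S ∩ ∁ ⁅ x ⁆
      rest⊆S : rest ⊆ S
      rest⊆S w∈rest = proj₁ (x∈p∩q⁻ S (∁ ⁅ x ⁆) w∈rest)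
      x∉rest : x ∉ rest
      x∉rest x∈rest = x∈∁p⇒x∉p (proj₂ (x∈p∩q⁻ S (∁ ⁅ x ⁆) x∈rest)) (x∈⁅x⁆ x)
      restore : rest ∪ ⁅ x ⁆ ≡ S
      restore = ⊆-antisym into onto
        where
        into : rest ∪ ⁅ x ⁆ ⊆ S
        into w∈ with x∈p∪q⁻ rest ⁅ x ⁆ w∈
        ... | inj₁ w∈rest = rest⊆S w∈rest
        ... | inj₂ w∈x    = ≡.subst (_∈ S) (≡.sym (x∈⁅y⁆⇒x≡y x w∈x)) x∈S
        onto : S ⊆ rest ∪ ⁅ x ⁆
        onto {w} w∈S with w ≟ x
        ... | yes ≡.refl = q⊆p∪q rest ⁅ x ⁆ (x∈⁅x⁆ x)
        ... | no  w≢x    = p⊆p∪q ⁅ x ⁆ (x∈p∩q⁺ (w∈S , x∉p⇒x∈∁p (x≢y⇒x∉⁅y⁆ w≢x)))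

module Adjacency {c ℓ} (F : Field c ℓ) {n} (G : Graph n) where
  open Field F hiding (zero)
  open LinAlg F
  open FieldProperties F
  open GraphModules G
  open import Relation.Binary.Reasoning.Setoid setoid

  _↾_ : Vector n → Subset n → Vector n
  (y ↾ S) w = if does (w ∈? S) then y w else 0#

  module _ (y : Vector n) where

    ↾-∈ : ∀ {S w} → w ∈ S → (y ↾ S) w ≡ y w
    ↾-∈ {S} {w} w∈S rewrite dec-true (w ∈? S) w∈S = ≡.refl

    ↾-∉ : ∀ {S w} → w ∉ S → (y ↾ S) w ≡ 0#
    ↾-∉ {S} {w} w∉S rewrite dec-false (w ∈? S) w∉S = ≡.refl

    ↾-∪ : ∀ {A B} → Disjoint A B → ∀ w → (y ↾ (A ∪ B)) w ≈ (y ↾ A) w + (y ↾ B) w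
    ↾-∪ {A} {B} disjoint w with w ∈? A | w ∈? B
    ... | yes w∈A | yes w∈B = ⊥-elim (disjoint w∈A w∈B)
    ... | yes w∈A | no  _   = trans (reflexive (↾-∈ (p⊆p∪q B w∈A))) (sym (+-identityʳ (y w)))
    ... | no  _   | yes w∈B = trans (reflexive (↾-∈ (q⊆p∪q A B w∈B))) (sym (+-identityˡ (y w)))
    ... | no  w∉A | no  w∉B = trans (reflexive (↾-∉ (∪-∉ w∉A w∉B))) (sym (+-identityˡ 0#))

    sum-↾-⁅⁆ : ∀ u → sumF (y ↾ ⁅ u ⁆) ≈ y u
    sum-↾-⁅⁆ u = trans (sumF-single (y ↾ ⁅ u ⁆) u λ w w≢u → reflexive (↾-∉ (x≢y⇒x∉⁅y⁆ w≢u)))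
                       (reflexive (↾-∈ (x∈⁅x⁆ u)))

  Amul-cong : ∀ {x x′ : Vector n} → (∀ w → x w ≈ x′ w) → ∀ v → Amul G x v ≈ Amul G x′ v
  Amul-cong x≈x′ v = sumF-cong (λ w → *-congˡ (x≈x′ w))

  Amul-+ : ∀ (x x′ : Vector n) v → Amul G (λ w → x w + x′ w) v ≈ Amul G x v + Amul G x′ v
  Amul-+ x x′ v = trans (sumF-cong (λ w → distribˡ (A G v w) (x w) (x′ w)))
                        (sumF-+ (λ w → A G v w * x w) (λ w → A G v w * x′ w))

  Amul-uniform : ∀ (y : Vector n) {B v} e → (∀ {w} → w ∈ B → adj G v w ≡ e) →
                 Amul G (y ↾ B) v ≈ (if e then sumF (y ↾ B) else 0#)
  Amul-uniform y {B} {v} true v-uniform = sumF-cong entry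
    where
    entry : ∀ w → A G v w * (y ↾ B) w ≈ (y ↾ B) w
    entry w with w ∈? B
    ... | yes w∈B rewrite v-uniform w∈B = *-identityˡ (y w)
    ... | no  _   = zeroʳ (A G v w)
  Amul-uniform y {B} {v} false v-uniform = sumF-zero entry
    where
    entry : ∀ w → A G v w * (y ↾ B) w ≈ 0#
    entry w with w ∈? B
    ... | yes w∈B rewrite v-uniform w∈B = zeroˡ (y w)
    ... | no  _   = zeroʳ (A G v w)

  Amul-↾-self : ∀ (y : Vector n) u → Amul G (y ↾ ⁅ u ⁆) u ≈ 0#
  Amul-↾-self y u = Amul-uniform y false λ w∈u →
    ≡.subst (λ w → adj G u w ≡ false) (≡.sym (x∈⁅y⁆⇒x≡y u w∈u)) (irref G u)

module Eigenvectors {c ℓ} (F : Field c ℓ) {n} (G : Graph n) where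
  open Field F hiding (zero)
  open LinAlg F
  open FieldProperties F
  open Adjacency F G
  open GraphModules G using (Twins)
  open import Algebra.Properties.CommutativeSemigroup *-commutativeSemigroup using (x∙yz≈y∙xz)
  open import Relation.Binary.Reasoning.Setoid setoid

  InEigenspace-combination : ∀ {λ′ k} (v : Fin k → Vector n) (a : Vector k) → (∀ j → InEigenspace G λ′ (v j)) →
                             InEigenspace G λ′ (λ i → sumF (λ j → a j * v j i))
  InEigenspace-combination {λ′} v a v-eigen i = begin
    sumF (λ z → A G i z * sumF (λ j → a j * v j z))
      ≈⟨ sumF-cong (λ z → *-distribˡ-sumF (A G i z) (λ j → a j * v j z)) ⟩
    sumF (λ z → sumF (λ j → A G i z * (a j * v j z)))
      ≈⟨ sumF-comm (λ z j → A G i z * (a j * v j z)) ⟩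
    sumF (λ j → sumF (λ z → A G i z * (a j * v j z)))
      ≈⟨ sumF-cong (λ j → sumF-cong (λ z → x∙yz≈y∙xz (A G i z) (a j) (v j z))) ⟩
    sumF (λ j → sumF (λ z → a j * (A G i z * v j z)))
      ≈⟨ sumF-cong (λ j → *-distribˡ-sumF (a j) (λ z → A G i z * v j z)) ⟨
    sumF (λ j → a j * Amul G (v j) i)
      ≈⟨ sumF-cong (λ j → *-congˡ (v-eigen j i)) ⟩
    sumF (λ j → a j * (λ′ * v j i))
      ≈⟨ sumF-cong (λ j → x∙yz≈y∙xz (a j) λ′ (v j i)) ⟩
    sumF (λ j → λ′ * (a j * v j i))
      ≈⟨ *-distribˡ-sumF λ′ (λ j → a j * v j i) ⟨
    λ′ * sumF (λ j → a j * v j i)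
      ∎

  restriction-independent : ∀ {λ′ m k} (r : Fin m → Fin n) →
    (∀ x → InEigenspace G λ′ x → (∀ i → x (r i) ≈ 0#) → ∀ u → x u ≈ 0#) →
    (v : Fin k → Vector n) → (∀ j → InEigenspace G λ′ (v j)) → LinearlyIndependent v →
    LinearlyIndependent (λ j i → v j (r i))
  restriction-independent r determined v v-eigen v-independent a combination≈0 =
    v-independent a (determined _ (InEigenspace-combination v a v-eigen) combination≈0)

  rowSum : (Fin n → Bool) → Vector n → Carrier
  rowSum row x = sumF (λ z → (if row z then 1# else 0#) * x z)

  rowSum-cong : ∀ {row row′} → (∀ z → row z ≡ row′ z) → ∀ x → rowSum row x ≈ rowSum row′ x
  rowSum-cong same x = sumF-cong (λ z → reflexive (≡.cong (λ b → (if b then 1# else 0#) * x z) (same z)))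

  rowSum-closed : ∀ x u → rowSum (N[ G ] u) x ≈ Amul G x u + x u
  rowSum-closed x u = begin
    rowSum (N[ G ] u) x                          ≈⟨ sumF-cong entry ⟩
    sumF (λ z → A G u z * x z + (x ↾ ⁅ u ⁆) z)    ≈⟨ sumF-+ (λ z → A G u z * x z) (x ↾ ⁅ u ⁆) ⟩
    Amul G x u + sumF (x ↾ ⁅ u ⁆)                 ≈⟨ +-congˡ (sum-↾-⁅⁆ x u) ⟩
    Amul G x u + x u                             ∎
    where
    entry : ∀ z → (if N[ G ] u z then 1# else 0#) * x z ≈ A G u z * x z + (x ↾ ⁅ u ⁆) z
    entry z with u ≟ z
    ... | yes ≡.refl rewrite irref G u | ↾-∈ x (x∈⁅x⁆ u) = begin
      1# * x u      ≈⟨ *-identityˡ (x u) ⟩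
      x u           ≈⟨ +-identityˡ (x u) ⟨
      0# + x u      ≈⟨ +-congʳ (zeroˡ (x u)) ⟨
      0# * x u + x u ∎
    ... | no  u≢z rewrite ↾-∉ x (x≢y⇒x∉⁅y⁆ (u≢z ∘ ≡.sym)) | Bool.∨-identityʳ (adj G u z) =
      sym (+-identityʳ (A G u z * x z))

  module _ {λ′ : Carrier} {x : Vector n} (x-eigen : InEigenspace G λ′ x) where

    duplicates-agree : λ′ ≉ 0# → ∀ {u w} → SameN G u w → x u ≈ x w
    duplicates-agree λ≉0 {u} {w} same = *-cancelˡ λ≉0 (begin
      λ′ * x u           ≈⟨ x-eigen u ⟨
      rowSum (N G u) x   ≈⟨ rowSum-cong same x ⟩
      rowSum (N G w) x   ≈⟨ x-eigen w ⟩
      λ′ * x w           ∎)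

    coduplicates-agree : λ′ ≉ - 1# → ∀ {u w} → SameN[] G u w → x u ≈ x w
    coduplicates-agree λ≉-1 {u} {w} same = *-cancelˡ (x≉-1⇒x+1≉0 λ≉-1) (begin
      (λ′ + 1#) * x u      ≈⟨ shifted u ⟩
      rowSum (N[ G ] u) x  ≈⟨ rowSum-cong same x ⟩
      rowSum (N[ G ] w) x  ≈⟨ shifted w ⟨
      (λ′ + 1#) * x w      ∎)
      where
      shifted : ∀ v → (λ′ + 1#) * x v ≈ rowSum (N[ G ] v) x
      shifted v = begin
        (λ′ + 1#) * x v       ≈⟨ distribʳ (x v) λ′ 1# ⟩
        λ′ * x v + 1# * x v   ≈⟨ +-cong (sym (x-eigen v)) (*-identityˡ (x v)) ⟩
        Amul G x v + x v      ≈⟨ rowSum-closed x v ⟨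
        rowSum (N[ G ] v) x   ∎

    twins-agree : λ′ ≉ 0# → λ′ ≉ - 1# → ∀ {u w} → Twins u w → x u ≈ x w
    twins-agree λ≉0 _    (inj₁ same) = duplicates-agree λ≉0 same
    twins-agree _   λ≉-1 (inj₂ same) = coduplicates-agree λ≉-1 same

module CographEigenvectors {c ℓ} (F : Field c ℓ) {n} (G : Graph n) (cograph : IsCograph G) where
  open Field F hiding (zero)
  open LinAlg F
  open FieldProperties F
  open GraphModules G
  open CographDecomposition G cograph using (decompose)
  open Adjacency F G
  open import Relation.Binary.Reasoning.Setoid setoid

  module _ {λ′ : Carrier} (λ≉0 : λ′ ≉ 0#) (λ≉-1 : λ′ ≉ - 1#) (y : Vector n)
           (twins-vanish : ∀ {u w} → u ≢ w → Twins u w → y u ≈ 0#) where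

    total : Subset n → Carrier
    total P = sumF (y ↾ P)

    Vanishes : Subset n → Set ℓ
    Vanishes P = ∀ {v} → v ∈ P → y v ≈ 0#

    -- On a module P, the vertices outside P contribute the same amount κ to (Ay) v for all v ∈ P.
    LocalEigen : Subset n → Carrier → Set ℓ
    LocalEigen P κ = ∀ {v} → v ∈ P → Amul G (y ↾ P) v + κ ≈ λ′ * y v

    data Outcome : Subset n → Carrier → Set (c ⊔ ℓ) where
      single : ∀ {u κ} → λ′ * y u ≈ κ → Outcome ⁅ u ⁆ κ
      vanish : ∀ {P κ} → Vanishes P → κ ≈ 0# → Outcome P κ

    vanishes-total : ∀ {P} → Vanishes P → total P ≈ 0#
    vanishes-total {P} vanishes = sumF-zero entry
      where
      entry : ∀ w → (y ↾ P) w ≈ 0#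
      entry w with w ∈? P
      ... | yes w∈P = vanishes w∈P
      ... | no  _   = refl

    outcome-total : ∀ {P κ} → Outcome P κ → λ′ * total P ≈ κ
    outcome-total (single {u} λy≈κ) = trans (*-congˡ (sum-↾-⁅⁆ y u)) λy≈κ
    outcome-total (vanish vanishes κ≈0) =
      trans (*-congˡ (vanishes-total vanishes)) (trans (zeroʳ λ′) (sym κ≈0))

    outcome-vanishes : ∀ {P κ} → Outcome P κ → κ ≈ 0# → Vanishes P
    outcome-vanishes (single λy≈κ) κ≈0 v∈u rewrite x∈⁅y⁆⇒x≡y _ v∈u =
      r*a≈0⇒a≈0 λ≉0 (trans λy≈κ κ≈0)
    outcome-vanishes (vanish vanishes _) _ = vanishes

    vanishes-∪ : ∀ {A B} → Vanishes A → Vanishes B → Vanishes (A ∪ B)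
    vanishes-∪ {A} {B} vanishes-A vanishes-B v∈ with x∈p∪q⁻ A B v∈
    ... | inj₁ v∈A = vanishes-A v∈A
    ... | inj₂ v∈B = vanishes-B v∈B

    local-part : ∀ {A B e κ} → Disjoint A B → Uniform e A B → LocalEigen (A ∪ B) κ →
                 LocalEigen A (κ + (if e then total B else 0#))
    local-part {A} {B} {e} {κ} disjoint uniform local {v} v∈A = begin
      Amul G (y ↾ A) v + (κ + t)                 ≈⟨ +-congˡ (+-comm κ t) ⟩
      Amul G (y ↾ A) v + (t + κ)                 ≈⟨ +-assoc _ t κ ⟨
      Amul G (y ↾ A) v + t + κ                   ≈⟨ +-congʳ (+-congˡ (Amul-uniform y e (uniform v∈A))) ⟨
      Amul G (y ↾ A) v + Amul G (y ↾ B) v + κ    ≈⟨ +-congʳ (Amul-+ (y ↾ A) (y ↾ B) v) ⟨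
      Amul G (λ w → (y ↾ A) w + (y ↾ B) w) v + κ ≈⟨ +-congʳ (Amul-cong (↾-∪ y disjoint) v) ⟨
      Amul G (y ↾ (A ∪ B)) v + κ                 ≈⟨ local (p⊆p∪q B v∈A) ⟩
      λ′ * y v                                   ∎
      where
      t = if e then total B else 0#

    one-part-vanishes : ∀ {A B κ κ′} → IsModule (A ∪ B) → Disjoint A B → Outcome A κ → Outcome B κ′ →
                        Vanishes A ⊎ Vanishes B
    one-part-vanishes _ _ (vanish vanishes-A _) _ = inj₁ vanishes-A
    one-part-vanishes _ _ (single _) (vanish vanishes-B _) = inj₂ vanishes-B
    one-part-vanishes module-uw disjoint (single {u} _) (single {w} _) =
      inj₁ λ v∈u → ≡.subst (λ v → y v ≈ 0#) (≡.sym (x∈⁅y⁆⇒x≡y u v∈u)) y-u≈0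
      where
      u≢w : u ≢ w
      u≢w u≡w = disjoint (x∈⁅x⁆ u) (≡.subst (_∈ ⁅ w ⁆) (≡.sym u≡w) (x∈⁅x⁆ w))
      y-u≈0 = twins-vanish u≢w (pair-module⇒twins module-uw)

    constant-vanishes : ∀ e {κ t} → κ + (if e then t else 0#) ≈ 0# → λ′ * t ≈ κ → κ ≈ 0#
    constant-vanishes false {κ} κ+0≈0 _ = trans (sym (+-identityʳ κ)) κ+0≈0
    constant-vanishes true {κ} {t} κ+t≈0 λt≈κ = begin
      κ      ≈⟨ +-identityʳ κ ⟨
      κ + 0# ≈⟨ +-congˡ t≈0 ⟨
      κ + t  ≈⟨ κ+t≈0 ⟩
      0#     ∎
      where
      t≈0 : t ≈ 0#
      t≈0 = r*a≈0⇒a≈0 (x≉-1⇒x+1≉0 λ≉-1) (begin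
        (λ′ + 1#) * t   ≈⟨ distribʳ t λ′ 1# ⟩
        λ′ * t + 1# * t ≈⟨ +-cong λt≈κ (*-identityˡ t) ⟩
        κ + t           ≈⟨ κ+t≈0 ⟩
        0#              ∎)

    other-part-vanishes : ∀ {A B e κ} → Vanishes A →
                          Outcome A (κ + (if e then total B else 0#)) → Outcome B (κ + (if e then total A else 0#)) →
                          Vanishes B × κ ≈ 0#
    other-part-vanishes {A} {B} {e} {κ} vanishes-A outcome-A outcome-B =
      outcome-vanishes outcome-B (trans κB≈κ κ≈0) , κ≈0
      where
      total-A≈0 = vanishes-total vanishes-A
      κA≈0 : κ + (if e then total B else 0#) ≈ 0#
      κA≈0 = trans (sym (outcome-total outcome-A)) (trans (*-congˡ total-A≈0) (zeroʳ λ′))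
      κB≈κ : κ + (if e then total A else 0#) ≈ κ
      κB≈κ = trans (+-congˡ (weight≈0 e)) (+-identityʳ κ)
        where
        weight≈0 : ∀ e → (if e then total A else 0#) ≈ 0#
        weight≈0 true  = total-A≈0
        weight≈0 false = refl
      κ≈0 : κ ≈ 0#
      κ≈0 = constant-vanishes e κA≈0 (trans (outcome-total outcome-B) κB≈κ)

    settle : ∀ {S κ} → Acc _⊂_ S → IsModule S → Nonempty S → LocalEigen S κ → Outcome S κ
    settle {S} {κ} (acc smaller) module-S (s , s∈S) local with decompose S
    ... | empty       = ⊥-elim (∉⊥ s∈S)
    ... | singleton u = single (begin
      λ′ * y u                       ≈⟨ local (x∈⁅x⁆ u) ⟨
      Amul G (y ↾ ⁅ u ⁆) u + κ       ≈⟨ +-congʳ (Amul-↾-self y u) ⟩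
      0# + κ                         ≈⟨ +-identityˡ κ ⟩
      κ                              ∎)
    ... | split {A} {B} e (a , a∈A) (b , b∈B) disjoint uniform =
      [ from-A , from-B ]′ (one-part-vanishes module-S disjoint outcome-A outcome-B)
      where
      A∪B≡B∪A = ∪-comm A B
      outcome-A : Outcome A (κ + (if e then total B else 0#))
      outcome-A = settle (smaller (p⊆p∪q B , b , q⊆p∪q A B b∈B , λ b∈A → disjoint b∈A b∈B))
        (module-of-part (≡.subst IsModule A∪B≡B∪A module-S) (Uniform-sym uniform))
        (a , a∈A) (local-part disjoint uniform local)
      outcome-B : Outcome B (κ + (if e then total A else 0#))
      outcome-B = settle (smaller (q⊆p∪q A B , a , p⊆p∪q B a∈A , disjoint a∈A))
        (module-of-part module-S uniform)
        (b , b∈B)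
        (local-part (Disjoint-sym disjoint) (Uniform-sym uniform) (≡.subst (λ S → LocalEigen S κ) A∪B≡B∪A local))
      from-A : Vanishes A → Outcome (A ∪ B) κ
      from-A vanishes-A = let (vanishes-B , κ≈0) = other-part-vanishes vanishes-A outcome-A outcome-B
                          in vanish (vanishes-∪ vanishes-A vanishes-B) κ≈0
      from-B : Vanishes B → Outcome (A ∪ B) κ
      from-B vanishes-B = let (vanishes-A , κ≈0) = other-part-vanishes vanishes-B outcome-B outcome-A
                          in vanish (vanishes-∪ vanishes-A vanishes-B) κ≈0

    eigenvector-vanishes : InEigenspace G λ′ y → ∀ v → y v ≈ 0#
    eigenvector-vanishes y-eigen v =
      outcome-vanishes (settle (⊂-wellFounded ⊤) ⊤-module (v , ∈⊤) local-⊤) refl ∈⊤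
      where
      ⊤-module : IsModule ⊤
      ⊤-module w∉⊤ = ⊥-elim (w∉⊤ ∈⊤)
      local-⊤ : LocalEigen ⊤ 0#
      local-⊤ {u} _ = trans (+-identityʳ _) (trans (Amul-cong (λ w → reflexive (↾-∈ y ∈⊤)) u) (y-eigen u))

module RowClasses {n} (row : Fin n → Fin n → Bool) where

  SameRow : Fin n → Fin n → Set
  SameRow u v = ∀ w → row u w ≡ row v w

  sameRow? : ∀ u v → Dec (SameRow u v)
  sameRow? u v = all? (λ w → row u w Bool.≟ row v w)

  rowClass : Fin n → Subset n
  rowClass u = select (sameRow? u)

  rowClass-isClass : ∀ {u w} → u ≢ w → SameRow u w → IsClassFor SameRow (rowClass u)
  rowClass-isClass {u} {w} u≢w same = large , related , maximal
    where
    u∈ : u ∈ rowClass u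
    u∈ = ∈-select⁺ (sameRow? u) (λ _ → ≡.refl)
    large : 1 < ∣ rowClass u ∣
    large = ≡.subst (_< ∣ rowClass u ∣) (∣⁅x⁆∣≡1 u)
      (p⊂q⇒∣p∣<∣q∣ ((λ v∈u → ≡.subst (_∈ rowClass u) (≡.sym (x∈⁅y⁆⇒x≡y u v∈u)) u∈) ,
                    w , ∈-select⁺ (sameRow? u) same , x≢y⇒x∉⁅y⁆ (u≢w ∘ ≡.sym)))
    related : ∀ a b → a ∈ rowClass u → b ∈ rowClass u → SameRow a b
    related a b a∈ b∈ z = ≡.trans (≡.sym (∈-select⁻ (sameRow? u) a∈ z)) (∈-select⁻ (sameRow? u) b∈ z)
    maximal : ∀ T → rowClass u ⊆ T → (∀ a b → a ∈ T → b ∈ T → SameRow a b) → T ≡ rowClass u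
    maximal T ⊆T related-T =
      ⊆-antisym (λ {z} z∈T → ∈-select⁺ (sameRow? u) (related-T u z (⊆T u∈) z∈T)) ⊆T

large⇒nonempty : ∀ {n} {S : Subset n} → 1 < ∣ S ∣ → Nonempty S
large⇒nonempty {n} {S} 1<∣S∣ with nonempty? S
... | yes nonempty = nonempty
... | no  empty    =
  ⊥-elim (n≮0 (≡.subst (1 <_) (∣⊥∣≡0 n) (≡.subst (λ T → 1 < ∣ T ∣) (Empty-unique empty) 1<∣S∣)))

module Representatives {n} (G : Graph n) (Ds Cs : List (Subset n))
                       (enumerates-D : Enumerates (IsDuplicationClass G) Ds)
                       (enumerates-C : Enumerates (IsCoduplicationClass G) Cs) where
  open GraphModules G using (Twins)

  classes : List (Subset n)
  classes = Ds ++ Cs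

  large : ∀ {S} → S LM.∈ classes → 1 < ∣ S ∣
  large {S} S∈ with ∈-++⁻ Ds S∈
  ... | inj₁ S∈Ds = proj₁ (Equivalence.to (proj₂ enumerates-D S) S∈Ds)
  ... | inj₂ S∈Cs = proj₁ (Equivalence.to (proj₂ enumerates-C S) S∈Cs)

  member : ∀ i → Nonempty (lookup classes i)
  member i = large⇒nonempty (large {lookup classes i} (∈-lookup i))

  representative : Fin (length classes) → Fin n
  representative i = proj₁ (member i)

  represented : ∀ {S} → S LM.∈ classes → ∃ λ i → representative i ∈ S
  represented S∈ =
    index S∈ , ≡.subst (representative (index S∈) ∈_) (≡.sym (lookup-index S∈)) (proj₂ (member (index S∈)))

  twin-representative : ∀ {u w} → u ≢ w → Twins u w → ∃ λ i → Twins u (representative i)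
  twin-representative {u} u≢w (inj₁ same) =
    let (i , r∈) = represented (∈-++⁺ˡ (Equivalence.from (proj₂ enumerates-D _) (rowClass-isClass u≢w same)))
    in i , inj₁ (∈-select⁻ (sameRow? u) r∈)
    where open RowClasses (N G)
  twin-representative {u} u≢w (inj₂ same) =
    let (i , r∈) = represented (∈-++⁺ʳ Ds (Equivalence.from (proj₂ enumerates-C _) (rowClass-isClass u≢w same)))
    in i , inj₂ (∈-select⁻ (sameRow? u) r∈)
    where open RowClasses (N[ G ])

theorem4p5 : ∀ {c ℓ} (F : Field c ℓ) → CharZero F →
    let open Field F in let open LinAlg F in
    ∀ {n : ℕ} (G : Graph n) → IsCograph G →
    ∀ (λ' : Carrier) → IsEigenvalue G λ' →
    ¬ (λ' ≈ 0#) → ¬ (λ' ≈ - 1#) →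
    ∀ (Ds Cs : List (Subset n)) →
    Enumerates (IsDuplicationClass G) Ds →
    Enumerates (IsCoduplicationClass G) Cs →
    MultiplicityAtMost G λ' (length Ds ℕ.+ length Cs)
theorem4p5 F _ G cograph λ′ _ λ≉0 λ≉-1 Ds Cs enumerates-D enumerates-C k v v-eigen v-independent =
  ≡.subst (k ≤_) (length-++ Ds)
    (independent⇒≤ (λ j i → v j (representative i))
      (restriction-independent representative determined v v-eigen v-independent))
  where
  open Field F
  open Independence F using (independent⇒≤)
  open Eigenvectors F G using (restriction-independent; twins-agree)
  open CographEigenvectors F G cograph using (eigenvector-vanishes)
  open Representatives G Ds Cs enumerates-D enumerates-C using (representative; twin-representative)
  determined : ∀ x → LinAlg.InEigenspace F G λ′ x → (∀ i → x (representative i) ≈ 0#) → ∀ u → x u ≈ 0#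
  determined x x-eigen at-representatives = eigenvector-vanishes λ≉0 λ≉-1 x twin-vanishes x-eigen
    where
    twin-vanishes : ∀ {u w} → u ≢ w → GraphModules.Twins G u w → x u ≈ 0#
    twin-vanishes u≢w twins = let (i , twins-i) = twin-representative u≢w twins
                              in trans (twins-agree x-eigen λ≉0 λ≉-1 twins-i) (at-representatives i)
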